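{- Let $G$ be a simple graph on vertex set $[n]$ which is the clique sum of two subgraphs $G_1$ and $G_2$ along a clique $K=G_1\cap G_2$. Then $X_G=X_{G_1}\cup X_{G_2}$, and this union is linearly joined along the coordinate subspace $X_K=\mathbb{P}(\mathrm{span}\{e_i: i\in K\})$. That is, $X_{G_1}\cap X_{G_2}=\langle X_{G_1}\rangle\cap\langle X_{G_2}\rangle=X_K$.
   Context: For a simple graph $H$ on a vertex subset of $[n]$, $X_H\subset\mathbb{P}^{n-1}$ denotes the subspace arrangement that is the union of the coordinate subspaces $\mathbb{P}(\mathrm{span}\{e_i: i\in C\})$ over all cliques $C$ of $H$. Here $e_i$ are the standard basis vectors. Equivalently, $X_H$ is the zero set of the square-free monomial ideal generated by $x_i$ for non-vertices $i$ of $H$ and by $x_ix_j$ for non-adjacent vertices $i\ne j$. $\langle X\rangle$ denotes the linear span of $X$ in $\mathbb{P}^{n-1}$. The clique sum of $G_1=(V_1,E_1)$ and $G_2=(V_2,E_2)$, where $V_1\cap V_2$ induces a clique in both graphs, is $(V_1\cup V_2,E_1\cup E_2)$. Two subspace arrangements $X_1,X_2$ have linearly joined union if $X_1\cap X_2=\langle X_1\rangle\cap\langle X_2\rangle$. -}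

module Defs where

open import Level using (Level; _⊔_; suc)
open import Algebra.Bundles using (CommutativeRing)
open import Data.Nat using (ℕ)
open import Data.Fin using (Fin)
open import Data.Fin.Subset using (Subset; _∈_; _∉_; _∪_; _∩_; ⊤)
open import Data.List using (List; []; _∷_)
open import Data.List.Relation.Unary.All using (All)
open import Data.Product using (Σ; ∃; _×_; _,_; proj₂)
open import Data.Sum using (_⊎_)
open import Relation.Nullary using (¬_)
open import Relation.Binary.PropositionalEquality using (_≡_; _≢_)

record Field (c ℓ : Level) : Set (suc (c ⊔ ℓ)) where
  field
    commutativeRing : CommutativeRing c ℓ
  open CommutativeRing commutativeRing public
  field
    0≉1     : ¬ (0# ≈ 1#)
    inverse : ∀ x → ¬ (x ≈ 0#) → Σ Carrier λ y → x * y ≈ 1#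

record Graph (n : ℕ) : Set₁ where
  field
    V      : Subset n
    E      : Fin n → Fin n → Set
    sym    : ∀ {i j} → E i j → E j i
    irrefl : ∀ {i} → ¬ E i i
    inV    : ∀ {i j} → E i j → i ∈ V × j ∈ V
open Graph public

IsClique : ∀ {n} → Graph n → Subset n → Set
IsClique H C = (∀ i → i ∈ C → i ∈ V H)
             × (∀ i j → i ∈ C → j ∈ C → i ≢ j → E H i j)

IsCliqueSum : ∀ {n} → Graph n → Graph n → Graph n → Set
IsCliqueSum G G₁ G₂ =
    (∀ i → i ∈ V G)
  × (∀ i → (i ∈ V G) ↔ (i ∈ V G₁ ⊎ i ∈ V G₂))
  × (∀ i j → (E G i j) ↔ (E G₁ i j ⊎ E G₂ i j))
  × IsClique G₁ (V G₁ ∩ V G₂)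
  × IsClique G₂ (V G₁ ∩ V G₂)
  where
  _↔_ : Set → Set → Set
  A ↔ B = (A → B) × (B → A)

-- A point of P^{n-1} is represented by a
-- nonzero vector of F^n (a representative); every set below is a cone
-- (closed under nonzero scaling), so it is a well-defined subset of
-- P^{n-1}.

module Geometry {c ℓ : Level} (F : Field c ℓ) where
  open Field F

  Vect : ℕ → Set c
  Vect n = Fin n → Carrier

  IsPoint : ∀ {n} → Vect n → Set ℓ
  IsPoint x = ∃ λ i → ¬ (x i ≈ 0#)

  PSet : ℕ → Set (suc (c ⊔ ℓ))
  PSet n = Vect n → Set (c ⊔ ℓ)

  CoordSub : ∀ {n} → Subset n → PSet n
  CoordSub C x = ∀ i → i ∉ C → Level.Lift c (x i ≈ 0#)

  X : ∀ {n} → Graph n → PSet n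
  X H x = Σ (Subset _) λ C → IsClique H C × CoordSub C x

  _∪ₚ_ : ∀ {n} → PSet n → PSet n → PSet n
  (A ∪ₚ B) x = A x ⊎ B x

  _∩ₚ_ : ∀ {n} → PSet n → PSet n → PSet n
  (A ∩ₚ B) x = A x × B x

  _≐_ : ∀ {n} → PSet n → PSet n → Set (c ⊔ ℓ)
  A ≐ B = ∀ x → IsPoint x → (A x → B x) × (B x → A x)

  0ᵥ : ∀ {n} → Vect n
  0ᵥ _ = 0#

  _+ᵥ_ : ∀ {n} → Vect n → Vect n → Vect n
  (x +ᵥ y) i = x i + y i

  _·ᵥ_ : ∀ {n} → Carrier → Vect n → Vect n
  (a ·ᵥ x) i = a * x i

  linComb : ∀ {n} → List (Carrier × Vect n) → Vect n
  linComb []             = 0ᵥ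
  linComb ((a , v) ∷ cs) = (a ·ᵥ v) +ᵥ linComb cs

  -- ⟨A⟩ : linear span of A, i.e. the projectivisation of the linear span
  -- of the cone over A: finite linear combinations of points of A.
  Span : ∀ {n} → PSet n → PSet n
  Span A y = Σ (List (Carrier × Vect _)) λ cs →
               All (λ p → A (proj₂ p)) cs × (∀ i → y i ≈ linComb cs i)

-- A clique of G containing a vertex outside G₁ has all its G-edges at that vertex in G₂,
-- so it lies in G₂; hence every clique of G is a clique of G₁ or of G₂.  Points of X G₁,
-- and therefore of their span, vanish off V G₁ (likewise for G₂), so the meet of the
-- spans lies in the coordinate subspace of K = V G₁ ∩ V G₂; as K is a clique of both
-- summands, that subspace lies in X G₁ ∩ X G₂.

module Submission where

open import Defs
open import Level using (Level; lift; lower)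
open import Data.Nat using (ℕ)
open import Data.Fin using (Fin; _≟_)
open import Data.Fin.Properties using (any?)
open import Data.Fin.Subset using (Subset; _∈_; _∉_; _⊆_; _∩_)
open import Data.Fin.Subset.Properties using (_∈?_; x∈p∩q⁺; ∩-comm)
open import Data.Product using (_×_; _,_; proj₁; proj₂; ∃)
open import Data.Sum using (_⊎_; inj₁; inj₂; [_,_]′; map; swap)
open import Data.List using (List; []; _∷_)
open import Data.List.Relation.Unary.All using (All; []; _∷_)
open import Relation.Nullary using (yes; no)
open import Relation.Nullary.Decidable using (_×-dec_; ¬?)
open import Relation.Binary.PropositionalEquality using (_≢_; subst)
open import Data.Empty using (⊥-elim)
open import Function using (_∘_)

private
  variable
    n : ℕ

⊆-or-escapes : (p q : Subset n) → p ⊆ q ⊎ ∃ λ i → i ∈ p × i ∉ q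
⊆-or-escapes p q with any? (λ i → i ∈? p ×-dec ¬? (i ∈? q))
... | yes escape = inj₂ escape
... | no ¬escape = inj₁ λ {i} i∈p → stays i i∈p
  where
  stays : ∀ i → i ∈ p → i ∈ q
  stays i i∈p with i ∈? q
  ... | yes i∈q = i∈q
  ... | no  i∉q = ⊥-elim (¬escape (i , i∈p , i∉q))

∉∩⇒∉⊎∉ : {i : Fin n} (p q : Subset n) → i ∉ p ∩ q → i ∉ p ⊎ i ∉ q
∉∩⇒∉⊎∉ {i = i} p q i∉p∩q with i ∈? p
... | yes i∈p = inj₂ λ i∈q → i∉p∩q (x∈p∩q⁺ (i∈p , i∈q))
... | no  i∉p = inj₁ i∉p

IsClique-subgraph : (H G : Graph n) →
  V H ⊆ V G → (∀ {i j} → E H i j → E G i j) →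
  {C : Subset n} → IsClique H C → IsClique G C
IsClique-subgraph H G V⊆ E⊆ (C⊆V , adjacent) =
  (λ i i∈C → V⊆ (C⊆V i i∈C)) , λ i j i∈C j∈C i≢j → E⊆ (adjacent i j i∈C j∈C i≢j)

IsCliqueSum-sym : (G G₁ G₂ : Graph n) → IsCliqueSum G G₁ G₂ → IsCliqueSum G G₂ G₁
IsCliqueSum-sym G G₁ G₂ (total , vertices , edges , K-clique₁ , K-clique₂) =
    total
  , (λ i → swap ∘ proj₁ (vertices i) , proj₂ (vertices i) ∘ swap)
  , (λ i j → swap ∘ proj₁ (edges i j) , proj₂ (edges i j) ∘ swap)
  , subst (IsClique G₂) (∩-comm (V G₁) (V G₂)) K-clique₂
  , subst (IsClique G₁) (∩-comm (V G₁) (V G₂)) K-clique₁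

module Summand {n : ℕ} (G G₁ G₂ : Graph n) (sum : IsCliqueSum G G₁ G₂) where
  private
    total     = proj₁ sum
    vertices  = proj₁ (proj₂ sum)
    edges     = proj₁ (proj₂ (proj₂ sum))
    K-clique₁ = proj₁ (proj₂ (proj₂ (proj₂ sum)))

  V₁⊆V : V G₁ ⊆ V G
  V₁⊆V i∈V₁ = proj₂ (vertices _) (inj₁ i∈V₁)

  E₁⊆E : ∀ {i j} → E G₁ i j → E G i j
  E₁⊆E e = proj₂ (edges _ _) (inj₁ e)

  -- An edge of G between vertices of G₁ coming from G₂ joins two vertices of K.
  clique-inside-V₁ : {C : Subset n} → IsClique G C → C ⊆ V G₁ → IsClique G₁ C
  clique-inside-V₁ {C} (_ , adjacent) C⊆V₁ = (λ i → C⊆V₁) , edge₁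
    where
    edge₁ : ∀ i j → i ∈ C → j ∈ C → i ≢ j → E G₁ i j
    edge₁ i j i∈C j∈C i≢j with proj₁ (edges i j) (adjacent i j i∈C j∈C i≢j)
    ... | inj₁ e = e
    ... | inj₂ e = proj₂ K-clique₁ i j (x∈p∩q⁺ (C⊆V₁ i∈C , proj₁ (inV G₂ e)))
                                        (x∈p∩q⁺ (C⊆V₁ j∈C , proj₂ (inV G₂ e))) i≢j

  outside-V₁⇒inside-V₂ : {a : Fin n} → a ∉ V G₁ → a ∈ V G₂
  outside-V₁⇒inside-V₂ {a} a∉V₁ =
    [ (λ a∈V₁ → ⊥-elim (a∉V₁ a∈V₁)) , (λ a∈V₂ → a∈V₂) ]′ (proj₁ (vertices a) (total a))

  clique-escaping-V₁ : {C : Subset n} → IsClique G C →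
    {a : Fin n} → a ∈ C → a ∉ V G₁ → C ⊆ V G₂
  clique-escaping-V₁ (_ , adjacent) {a} a∈C a∉V₁ {i} i∈C with a ≟ i
  ... | yes a≡i = subst (_∈ V G₂) a≡i (outside-V₁⇒inside-V₂ a∉V₁)
  ... | no  a≢i = [ (λ e → ⊥-elim (a∉V₁ (proj₁ (inV G₁ e)))) , (λ e → proj₂ (inV G₂ e)) ]′
                    (proj₁ (edges a i) (adjacent a i a∈C i∈C a≢i))

module CliqueSum {n : ℕ} (G G₁ G₂ : Graph n) (sum : IsCliqueSum G G₁ G₂) where
  open Summand G G₁ G₂ sum
  open Summand G G₂ G₁ (IsCliqueSum-sym G G₁ G₂ sum) using ()
    renaming (clique-inside-V₁ to clique-inside-V₂; V₁⊆V to V₂⊆V; E₁⊆E to E₂⊆E)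

  clique-of-sum : {C : Subset n} → IsClique G C → IsClique G₁ C ⊎ IsClique G₂ C
  clique-of-sum {C} C-clique with ⊆-or-escapes C (V G₁)
  ... | inj₁ C⊆V₁ = inj₁ (clique-inside-V₁ C-clique C⊆V₁)
  ... | inj₂ (a , a∈C , a∉V₁) =
    inj₂ (clique-inside-V₂ C-clique (clique-escaping-V₁ C-clique a∈C a∉V₁))

  summand-clique : {C : Subset n} → IsClique G₁ C ⊎ IsClique G₂ C → IsClique G C
  summand-clique =
    [ IsClique-subgraph G₁ G V₁⊆V E₁⊆E , IsClique-subgraph G₂ G V₂⊆V E₂⊆E ]′

module _ {c ℓ : Level} (F : Field c ℓ) where
  open Field F using (Carrier; _≈_; 0#; 1#; _+_; _*_; +-cong; *-cong; zeroʳ; +-identityʳ; *-identityˡ)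
    renaming (refl to ≈-refl; sym to ≈-sym; trans to ≈-trans)
  open Geometry F

  linComb-vanishes : {A : PSet n} {i : Fin n} → (∀ {x} → A x → x i ≈ 0#) →
    (cs : List (Carrier × Vect n)) → All (λ p → A (proj₂ p)) cs → linComb cs i ≈ 0#
  linComb-vanishes A-vanishes []             []          = ≈-refl
  linComb-vanishes A-vanishes ((a , v) ∷ cs) (v∈A ∷ cs∈A) =
    ≈-trans (+-cong (≈-trans (*-cong ≈-refl (A-vanishes v∈A)) (zeroʳ a))
                    (linComb-vanishes A-vanishes cs cs∈A))
            (+-identityʳ 0#)

  Span-vanishes : {A : PSet n} {i : Fin n} → (∀ {x} → A x → x i ≈ 0#) →
    ∀ {y} → Span A y → y i ≈ 0#
  Span-vanishes A-vanishes (cs , cs∈A , y≈cs) =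
    ≈-trans (y≈cs _) (linComb-vanishes A-vanishes cs cs∈A)

  ⊆-Span : {A : PSet n} → ∀ {x} → A x → Span A x
  ⊆-Span {x = x} x∈A =
    (1# , x) ∷ [] , x∈A ∷ [] , λ i → ≈-sym (≈-trans (+-identityʳ (1# * x i)) (*-identityˡ (x i)))

  X-vanishes-outside-V : (H : Graph n) {i : Fin n} → i ∉ V H → ∀ {x} → X H x → x i ≈ 0#
  X-vanishes-outside-V H i∉V (C , (C⊆V , _) , x∈C) = lower (x∈C _ λ i∈C → i∉V (C⊆V _ i∈C))

  ∩ₚ-Span : {A B : PSet n} → ∀ {x} → (A ∩ₚ B) x → (Span A ∩ₚ Span B) x
  ∩ₚ-Span (x∈A , x∈B) = ⊆-Span x∈A , ⊆-Span x∈B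

  module CliqueSumGeometry {n : ℕ} (G G₁ G₂ : Graph n) (sum : IsCliqueSum G G₁ G₂) where
    open CliqueSum G G₁ G₂ sum

    private
      K = V G₁ ∩ V G₂
      K-clique₁ = proj₁ (proj₂ (proj₂ (proj₂ sum)))
      K-clique₂ = proj₂ (proj₂ (proj₂ (proj₂ sum)))

    X-sum⊆X-union : ∀ {x} → X G x → (X G₁ ∪ₚ X G₂) x
    X-sum⊆X-union (C , C-clique , x∈C) =
      map (λ Cᵢ → C , Cᵢ , x∈C) (λ Cᵢ → C , Cᵢ , x∈C) (clique-of-sum C-clique)

    X-union⊆X-sum : ∀ {x} → (X G₁ ∪ₚ X G₂) x → X G x
    X-union⊆X-sum (inj₁ (C , C-clique , x∈C)) = C , summand-clique (inj₁ C-clique) , x∈C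
    X-union⊆X-sum (inj₂ (C , C-clique , x∈C)) = C , summand-clique (inj₂ C-clique) , x∈C

    CoordSub-K⊆X-meet : ∀ {x} → CoordSub K x → (X G₁ ∩ₚ X G₂) x
    CoordSub-K⊆X-meet x∈K = (K , K-clique₁ , x∈K) , (K , K-clique₂ , x∈K)

    Span-meet⊆CoordSub-K : ∀ {y} → (Span (X G₁) ∩ₚ Span (X G₂)) y → CoordSub K y
    Span-meet⊆CoordSub-K (y∈⟨X₁⟩ , y∈⟨X₂⟩) i i∉K = lift ([
        (λ i∉V₁ → Span-vanishes (X-vanishes-outside-V G₁ i∉V₁) y∈⟨X₁⟩)
      , (λ i∉V₂ → Span-vanishes (X-vanishes-outside-V G₂ i∉V₂) y∈⟨X₂⟩)
      ]′ (∉∩⇒∉⊎∉ (V G₁) (V G₂) i∉K))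

proposition1p10 : ∀ {c ℓ : Level} (F : Field c ℓ) {n : ℕ} (G G₁ G₂ : Graph n) →
    IsCliqueSum G G₁ G₂ →
    let open Geometry F in
      (X G ≐ (X G₁ ∪ₚ X G₂))
      × ((X G₁ ∩ₚ X G₂) ≐ (Span (X G₁) ∩ₚ Span (X G₂)))
      × ((Span (X G₁) ∩ₚ Span (X G₂)) ≐ CoordSub (V G₁ ∩ V G₂))
proposition1p10 F G G₁ G₂ sum =
    (λ _ _ → X-sum⊆X-union , X-union⊆X-sum)
  , (λ _ _ → ∩ₚ-Span F , CoordSub-K⊆X-meet ∘ Span-meet⊆CoordSub-K)
  , (λ _ _ → Span-meet⊆CoordSub-K , ∩ₚ-Span F ∘ CoordSub-K⊆X-meet)
  where open CliqueSumGeometry F G G₁ G₂ sum
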